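{- Let $G$ be a stepwise irregular graph of order $n$ and cyclomatic number $\gamma$ possessing a vertex of degree $1$. Then for every $k=1,2,\dots$ and every $i\in\{0,1,2\}$ there exists a stepwise irregular graph of order $n+4k+i$ and cyclomatic number $\gamma+i$.
   Context: All graphs are finite and simple. A graph $G$ is stepwise irregular (SI) if for every edge $uv\in E(G)$ one has $|d_G(u)-d_G(v)|=1$, where $d_G$ denotes degree. The order of a graph is its number of vertices. The cyclomatic number of a connected graph with $n$ vertices and $m$ edges is $\gamma=m-n+1$. -}

module Defs where

open import Data.Nat using (ℕ; _+_; _<ᵇ_; ∣_-_∣)
open import Data.Bool using (Bool; true; false; T; if_then_else_; _∧_)
open import Data.Fin using (Fin; toℕ)
open import Data.List using (map; allFin)
open import Data.Nat.ListAction using (sum)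
open import Data.Integer as ℤ using (ℤ; +_)
open import Relation.Binary.PropositionalEquality using (_≡_)
open import Relation.Binary.Construct.Closure.ReflexiveTransitive using (Star)

record Graph (n : ℕ) : Set where
  field
    adj    : Fin n → Fin n → Bool
    adj-sym : ∀ u v → adj u v ≡ adj v u
    irrefl : ∀ u → adj u u ≡ false
open Graph public

Adj : ∀ {n} → Graph n → Fin n → Fin n → Set
Adj G u v = T (adj G u v)

degree : ∀ {n} → Graph n → Fin n → ℕ
degree {n} G u = sum (map (λ v → if adj G u v then 1 else 0) (allFin n))

edgeCount : ∀ {n} → Graph n → ℕ
edgeCount {n} G =
  sum (map (λ u → sum (map (λ v → if (toℕ u <ᵇ toℕ v) ∧ adj G u v then 1 else 0)
                            (allFin n)))
           (allFin n))

Connected : ∀ {n} → Graph n → Set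
Connected G = ∀ u v → Star (Adj G) u v

StepwiseIrregular : ∀ {n} → Graph n → Set
StepwiseIrregular G = ∀ u v → Adj G u v → ∣ degree G u - degree G v ∣ ≡ 1

cyclomatic : ∀ {n} → Graph n → ℤ
cyclomatic {n} G = (+ edgeCount G ℤ.- + n) ℤ.+ + 1

module Submission where

-- Let v be a pendant vertex of a connected stepwise irregular (SI) graph G.
-- Its unique neighbour has degree 2, so if we glue onto v a small graph K
-- (a "gadget") by joining v to exactly two "ports" of K, then v gets degree 3
-- and every host edge stays stepwise.  The glued graph is again connected and
-- SI provided (i) K stays stepwise inside once each port gains one degree,
-- (ii) each port then has degree 2 or 4, and (iii) every vertex of K reaches a
-- port.  A gadget on m vertices with m + c - 2 edges raises the order by m and
-- the cyclomatic number by c.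
--
-- Three concrete gadgets follow, checked by computation:
-- gadget₀ (4 vertices, c = 0, and it leaves a new pendant vertex), gadget₁
-- (5 vertices, c = 1) and gadget₂ (6 vertices, c = 2).  For k ≥ 1, gluing
-- gadget₀ k - 1 times and then the gadget with 4 + i vertices gives order
-- n + 4k + i and cyclomatic number γ + i, which is the theorem.

open import Defs
open import Data.Nat using (ℕ; zero; suc; _+_; _*_; _≤_; _<ᵇ_; _≡ᵇ_; ∣_-_∣; z≤n; s≤s)
open import Data.Nat.Properties
  using (+-assoc; ∣-∣-comm; m≤m+n; ≤-trans; n≮n; <ᵇ⇒<; +-0-commutativeMonoid)
  renaming (_≟_ to _≟ℕ_)
import Data.Nat.ListAction as List
open import Data.Nat.Tactic.RingSolver using (solve-∀)
open import Data.Bool using (Bool; true; false; T; if_then_else_; _∧_; _∨_)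
open import Data.Bool.Properties using (∧-identityʳ; ∧-zeroʳ; ∨-comm; T-∧)
open import Data.Fin using (Fin; zero; suc; toℕ; _↑ˡ_; _↑ʳ_; splitAt)
open import Data.Fin.Properties using (_≟_; all?; splitAt-↑ˡ; splitAt-↑ʳ)
open import Data.Fin.Patterns using (0F; 1F; 2F; 3F; 4F; 5F)
open import Data.List using (List; []; _∷_; map; allFin; tabulate)
open import Data.Bool.ListAction using (any)
open import Data.List.Properties using (map-tabulate)
open import Data.Integer as ℤ using (+_)
open import Data.Integer.Properties using (pos-+)
import Data.Integer.Tactic.RingSolver as ℤ-Solver
open import Data.Product using (Σ; ∃; _×_; _,_; proj₁; proj₂)
open import Data.Sum using (_⊎_; inj₁; inj₂)
open import Data.Empty using (⊥-elim)
open import Data.Unit using (tt)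
open import Function using (_∘_; id; Equivalence)
open import Relation.Nullary using (yes; no)
open import Relation.Nullary.Decidable
  using (does; Dec; T?; _→-dec_; toWitness; dec-true; dec-false)
open import Relation.Binary.PropositionalEquality
  using (_≡_; _≢_; refl; sym; trans; cong; cong₂; subst; module ≡-Reasoning)
open import Relation.Binary.Construct.Closure.ReflexiveTransitive
  using (Star; ε; _◅_; _◅◅_; gmap; reverse)

open import Algebra.Properties.CommutativeMonoid.Sum +-0-commutativeMonoid
  using (sum; sum-cong-≗; sum-replicate-zero; sum-remove; ∑-distrib-+)

open Equivalence using (to; from)

ind : Bool → ℕ
ind b = if b then 1 else 0

ind-T : ∀ {b} → T b → ind b ≡ 1
ind-T {true} _ = refl

sum-allFin : ∀ n (f : Fin n → ℕ) → List.sum (map f (allFin n)) ≡ sum f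
sum-allFin n f = trans (cong List.sum (map-tabulate id f)) (sum-tabulate f)
  where
  sum-tabulate : ∀ {k} (g : Fin k → ℕ) → List.sum (tabulate g) ≡ sum g
  sum-tabulate {zero}  g = refl
  sum-tabulate {suc k} g = cong (_+_ (g zero)) (sum-tabulate (g ∘ suc))

term≤sum : ∀ {n} (f : Fin n → ℕ) i → f i ≤ sum f
term≤sum {suc n} f i = subst (f i ≤_) (sym (sum-remove {i = i} f)) (m≤m+n (f i) _)

sum-↑ : ∀ m {n} (f : Fin (m + n) → ℕ) →
        sum f ≡ sum (λ a → f (a ↑ˡ n)) + sum (λ w → f (m ↑ʳ w))
sum-↑ zero    f = refl
sum-↑ (suc m) f = trans (cong (_+_ (f zero)) (sum-↑ m (f ∘ suc))) (sym (+-assoc (f zero) _ _))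

sum-≟ : ∀ {n} (v : Fin n) → sum (λ w → ind (does (w ≟ v))) ≡ 1
sum-≟ {suc n} zero    = cong suc (sum-replicate-zero n)
sum-≟ {suc n} (suc v) = sum-≟ v

sum-∧ˡ : ∀ {n} b (f : Fin n → Bool) → sum (λ x → ind (b ∧ f x)) ≡ (if b then sum (ind ∘ f) else 0)
sum-∧ˡ     true  f = refl
sum-∧ˡ {n} false f = sum-replicate-zero n

sum-∧ʳ : ∀ {n} (f : Fin n → Bool) b → sum (λ x → ind (f x ∧ b)) ≡ (if b then sum (ind ∘ f) else 0)
sum-∧ʳ     f true  = sum-cong-≗ (λ x → cong ind (∧-identityʳ (f x)))
sum-∧ʳ {n} f false = trans (sum-cong-≗ (λ x → cong ind (∧-zeroʳ (f x)))) (sum-replicate-zero n)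

degree-sum : ∀ {n} (G : Graph n) u → degree G u ≡ sum (λ w → ind (adj G u w))
degree-sum {n} G u = sum-allFin n (λ w → ind (adj G u w))

forwardDegree : ∀ {n} → Graph n → Fin n → ℕ
forwardDegree G u = sum (λ w → ind ((toℕ u <ᵇ toℕ w) ∧ adj G u w))

edgeCount-sum : ∀ {n} (G : Graph n) → edgeCount G ≡ sum (forwardDegree G)
edgeCount-sum {n} G =
  trans (sum-allFin n _) (sum-cong-≗ λ u → sum-allFin n (λ w → ind ((toℕ u <ᵇ toℕ w) ∧ adj G u w)))

Adj-sym : ∀ {n} (G : Graph n) {u w} → Adj G u w → Adj G w u
Adj-sym G {u} {w} = subst T (adj-sym G u w)

degree-pos : ∀ {n} (G : Graph n) {u w} → Adj G u w → 1 ≤ degree G u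
degree-pos G {u} {w} e = subst (1 ≤_) (sym (degree-sum G u))
  (≤-trans (subst (1 ≤_) (sym (ind-T e)) (s≤s z≤n)) (term≤sum (λ x → ind (adj G u x)) w))

pendant-neighbour : ∀ {n} (G : Graph n) → StepwiseIrregular G →
                    ∀ {v w} → degree G v ≡ 1 → Adj G v w → degree G w ≡ 2
pendant-neighbour G si {v} {w} dv e =
  one-off (degree G w) (degree-pos G (Adj-sym G e)) (subst (λ d → ∣ d - degree G w ∣ ≡ 1) dv (si v w e))
  where
  one-off : ∀ d → 1 ≤ d → ∣ 1 - d ∣ ≡ 1 → d ≡ 2
  one-off (suc zero)          _ ()
  one-off (suc (suc zero))    _ _ = refl
  one-off (suc (suc (suc _))) _ ()

data Block (m n : ℕ) : Fin (m + n) → Set where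
  first  : ∀ a → Block m n (a ↑ˡ n)
  second : ∀ w → Block m n (m ↑ʳ w)

block : ∀ m n (x : Fin (m + n)) → Block m n x
block zero    n x       = second x
block (suc m) n zero    = first zero
block (suc m) n (suc x) with block m n x
... | first a  = first (suc a)
... | second w = second w

↑ˡ<ᵇ↑ˡ : ∀ {m} n (a b : Fin m) → (toℕ (a ↑ˡ n) <ᵇ toℕ (b ↑ˡ n)) ≡ (toℕ a <ᵇ toℕ b)
↑ˡ<ᵇ↑ˡ n zero    zero    = refl
↑ˡ<ᵇ↑ˡ n zero    (suc b) = refl
↑ˡ<ᵇ↑ˡ n (suc a) zero    = refl
↑ˡ<ᵇ↑ˡ n (suc a) (suc b) = ↑ˡ<ᵇ↑ˡ n a b

↑ˡ<ᵇ↑ʳ : ∀ {m n} (a : Fin m) (w : Fin n) → (toℕ (a ↑ˡ n) <ᵇ toℕ (m ↑ʳ w)) ≡ true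
↑ˡ<ᵇ↑ʳ zero    w = refl
↑ˡ<ᵇ↑ʳ (suc a) w = ↑ˡ<ᵇ↑ʳ a w

↑ʳ<ᵇ↑ˡ : ∀ {m n} (w : Fin n) (a : Fin m) → (toℕ (m ↑ʳ w) <ᵇ toℕ (a ↑ˡ n)) ≡ false
↑ʳ<ᵇ↑ˡ w zero    = refl
↑ʳ<ᵇ↑ˡ w (suc a) = ↑ʳ<ᵇ↑ˡ w a

↑ʳ<ᵇ↑ʳ : ∀ m {n} (w w′ : Fin n) → (toℕ (m ↑ʳ w) <ᵇ toℕ (m ↑ʳ w′)) ≡ (toℕ w <ᵇ toℕ w′)
↑ʳ<ᵇ↑ʳ zero    w w′ = refl
↑ʳ<ᵇ↑ʳ (suc m) w w′ = ↑ʳ<ᵇ↑ʳ m w w′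

-- The gluing conditions on a gadget K whose ports will all be joined to one
-- host vertex of degree 3.  'gluedDegree' is the degree of a gadget vertex
-- after gluing.
gluedDegree : ∀ {m} → Graph m → (Fin m → Bool) → Fin m → ℕ
gluedDegree K port a = degree K a + ind (port a)

StaysStepwise : ∀ {m} → Graph m → (Fin m → Bool) → Set
StaysStepwise K port = ∀ a b → Adj K a b → ∣ gluedDegree K port a - gluedDegree K port b ∣ ≡ 1

PortsFit : ∀ {m} → Graph m → (Fin m → Bool) → Set
PortsFit K port = ∀ a → T (port a) → ∣ gluedDegree K port a - 3 ∣ ≡ 1

ReachesPort : ∀ {m} → Graph m → (Fin m → Bool) → Set
ReachesPort {m} K port = ∀ a → ∃ λ (p : Fin m) → T (port p) × Star (Adj K) a p

module Gluing {m n} (K : Graph m) (port : Fin m → Bool) (G : Graph n) (v : Fin n) where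

  joins : Fin m → Fin n → Bool
  joins a w = port a ∧ does (w ≟ v)

  adjᵤ : Fin m ⊎ Fin n → Fin m ⊎ Fin n → Bool
  adjᵤ (inj₁ a) (inj₁ b)  = adj K a b
  adjᵤ (inj₁ a) (inj₂ w)  = joins a w
  adjᵤ (inj₂ w) (inj₁ a)  = joins a w
  adjᵤ (inj₂ w) (inj₂ w′) = adj G w w′

  adjᵤ-sym : ∀ x y → adjᵤ x y ≡ adjᵤ y x
  adjᵤ-sym (inj₁ a) (inj₁ b)  = adj-sym K a b
  adjᵤ-sym (inj₁ a) (inj₂ w)  = refl
  adjᵤ-sym (inj₂ w) (inj₁ a)  = refl
  adjᵤ-sym (inj₂ w) (inj₂ w′) = adj-sym G w w′

  adjᵤ-irrefl : ∀ x → adjᵤ x x ≡ false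
  adjᵤ-irrefl (inj₁ a) = irrefl K a
  adjᵤ-irrefl (inj₂ w) = irrefl G w

  glued : Graph (m + n)
  glued = record
    { adj     = λ x y → adjᵤ (splitAt m x) (splitAt m y)
    ; adj-sym = λ x y → adjᵤ-sym (splitAt m x) (splitAt m y)
    ; irrefl  = λ x → adjᵤ-irrefl (splitAt m x)
    }

  adj-KK : ∀ a b → adj glued (a ↑ˡ n) (b ↑ˡ n) ≡ adj K a b
  adj-KK a b rewrite splitAt-↑ˡ m a n | splitAt-↑ˡ m b n = refl

  adj-KG : ∀ a w → adj glued (a ↑ˡ n) (m ↑ʳ w) ≡ joins a w
  adj-KG a w rewrite splitAt-↑ˡ m a n | splitAt-↑ʳ m n w = refl

  adj-GK : ∀ w a → adj glued (m ↑ʳ w) (a ↑ˡ n) ≡ joins a w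
  adj-GK w a rewrite splitAt-↑ˡ m a n | splitAt-↑ʳ m n w = refl

  adj-GG : ∀ w w′ → adj glued (m ↑ʳ w) (m ↑ʳ w′) ≡ adj G w w′
  adj-GG w w′ rewrite splitAt-↑ʳ m n w | splitAt-↑ʳ m n w′ = refl

  portCount : ℕ
  portCount = sum (ind ∘ port)

  joins-count : ∀ a → sum (λ w → ind (joins a w)) ≡ ind (port a)
  joins-count a = trans (sum-∧ˡ (port a) (λ w → does (w ≟ v)))
                        (cong (λ s → if port a then s else 0) (sum-≟ v))

  degree-K : ∀ a → degree glued (a ↑ˡ n) ≡ gluedDegree K port a
  degree-K a = begin
    degree glued (a ↑ˡ n)
      ≡⟨ trans (degree-sum glued _) (sum-↑ m _) ⟩
    sum (λ b → ind (adj glued (a ↑ˡ n) (b ↑ˡ n))) + sum (λ w → ind (adj glued (a ↑ˡ n) (m ↑ʳ w)))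
      ≡⟨ cong₂ _+_ (sum-cong-≗ (cong ind ∘ adj-KK a)) (sum-cong-≗ (cong ind ∘ adj-KG a)) ⟩
    sum (λ b → ind (adj K a b)) + sum (λ w → ind (joins a w))
      ≡⟨ cong₂ _+_ (sym (degree-sum K a)) (joins-count a) ⟩
    degree K a + ind (port a) ∎
    where open ≡-Reasoning

  degree-G : ∀ w → degree glued (m ↑ʳ w) ≡ (if does (w ≟ v) then portCount else 0) + degree G w
  degree-G w = begin
    degree glued (m ↑ʳ w)
      ≡⟨ trans (degree-sum glued _) (sum-↑ m _) ⟩
    sum (λ a → ind (adj glued (m ↑ʳ w) (a ↑ˡ n))) + sum (λ w′ → ind (adj glued (m ↑ʳ w) (m ↑ʳ w′)))
      ≡⟨ cong₂ _+_ (sum-cong-≗ (cong ind ∘ adj-GK w)) (sum-cong-≗ (cong ind ∘ adj-GG w)) ⟩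
    sum (λ a → ind (port a ∧ does (w ≟ v))) + sum (λ w′ → ind (adj G w w′))
      ≡⟨ cong₂ _+_ (sum-∧ʳ port (does (w ≟ v))) (sym (degree-sum G w)) ⟩
    (if does (w ≟ v) then portCount else 0) + degree G w ∎
    where open ≡-Reasoning

  degree-v : degree glued (m ↑ʳ v) ≡ portCount + degree G v
  degree-v = trans (degree-G v)
    (cong (λ b → (if b then portCount else 0) + degree G v) (dec-true (v ≟ v) refl))

  degree-away : ∀ {w} → w ≢ v → degree glued (m ↑ʳ w) ≡ degree G w
  degree-away {w} w≢v = trans (degree-G w)
    (cong (λ b → (if b then portCount else 0) + degree G w) (dec-false (w ≟ v) w≢v))

  forward-K : ∀ a → forwardDegree glued (a ↑ˡ n) ≡ forwardDegree K a + ind (port a)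
  forward-K a = trans (sum-↑ m _) (cong₂ _+_ (sum-cong-≗ inside) (trans (sum-cong-≗ across) (joins-count a)))
    where
    inside : ∀ b → ind ((toℕ (a ↑ˡ n) <ᵇ toℕ (b ↑ˡ n)) ∧ adj glued (a ↑ˡ n) (b ↑ˡ n))
                 ≡ ind ((toℕ a <ᵇ toℕ b) ∧ adj K a b)
    inside b rewrite ↑ˡ<ᵇ↑ˡ n a b | adj-KK a b = refl
    across : ∀ w → ind ((toℕ (a ↑ˡ n) <ᵇ toℕ (m ↑ʳ w)) ∧ adj glued (a ↑ˡ n) (m ↑ʳ w))
                 ≡ ind (joins a w)
    across w rewrite ↑ˡ<ᵇ↑ʳ a w | adj-KG a w = refl

  forward-G : ∀ w → forwardDegree glued (m ↑ʳ w) ≡ forwardDegree G w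
  forward-G w = trans (sum-↑ m _)
    (cong₂ _+_ (trans (sum-cong-≗ backwards) (sum-replicate-zero m)) (sum-cong-≗ inside))
    where
    backwards : ∀ a → ind ((toℕ (m ↑ʳ w) <ᵇ toℕ (a ↑ˡ n)) ∧ adj glued (m ↑ʳ w) (a ↑ˡ n)) ≡ 0
    backwards a rewrite ↑ʳ<ᵇ↑ˡ w a = refl
    inside : ∀ w′ → ind ((toℕ (m ↑ʳ w) <ᵇ toℕ (m ↑ʳ w′)) ∧ adj glued (m ↑ʳ w) (m ↑ʳ w′))
                  ≡ ind ((toℕ w <ᵇ toℕ w′) ∧ adj G w w′)
    inside w′ rewrite ↑ʳ<ᵇ↑ʳ m w w′ | adj-GG w w′ = refl

  edgeCount-glued : edgeCount glued ≡ (edgeCount K + portCount) + edgeCount G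
  edgeCount-glued = begin
    edgeCount glued
      ≡⟨ trans (edgeCount-sum glued) (sum-↑ m _) ⟩
    sum (λ a → forwardDegree glued (a ↑ˡ n)) + sum (λ w → forwardDegree glued (m ↑ʳ w))
      ≡⟨ cong₂ _+_ (trans (sum-cong-≗ forward-K) (∑-distrib-+ (forwardDegree K) (ind ∘ port)))
                   (sum-cong-≗ forward-G) ⟩
    (sum (forwardDegree K) + portCount) + sum (forwardDegree G)
      ≡⟨ cong₂ (λ x y → (x + portCount) + y) (sym (edgeCount-sum K)) (sym (edgeCount-sum G)) ⟩
    (edgeCount K + portCount) + edgeCount G ∎
    where open ≡-Reasoning

  module Invariants (conG : Connected G) (siG : StepwiseIrregular G) (pendant : degree G v ≡ 1)
                    (twoPorts : portCount ≡ 2) (stays : StaysStepwise K port)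
                    (fit : PortsFit K port) (reach : ReachesPort K port) where

    -- v gains the two ports and keeps its old neighbour.
    degree-v≡3 : degree glued (m ↑ʳ v) ≡ 3
    degree-v≡3 = trans degree-v (cong₂ _+_ twoPorts pendant)

    -- The former neighbour of v has degree 2 < 3, every other host edge is untouched.
    stepwise-GG : ∀ w w′ → Adj G w w′ → ∣ degree glued (m ↑ʳ w) - degree glued (m ↑ʳ w′) ∣ ≡ 1
    stepwise-GG w w′ e with w ≟ v | w′ ≟ v
    ... | yes refl | yes refl = ⊥-elim (subst T (irrefl G w) e)
    ... | yes refl | no w′≢v  =
      cong₂ ∣_-_∣ degree-v≡3 (trans (degree-away w′≢v) (pendant-neighbour G siG pendant e))
    ... | no w≢v   | yes refl =
      cong₂ ∣_-_∣ (trans (degree-away w≢v) (pendant-neighbour G siG pendant (Adj-sym G e))) degree-v≡3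
    ... | no w≢v   | no w′≢v  =
      trans (cong₂ ∣_-_∣ (degree-away w≢v) (degree-away w′≢v)) (siG w w′ e)

    -- The only edges between the blocks join a port to v.
    stepwise-KG : ∀ a w → Adj glued (a ↑ˡ n) (m ↑ʳ w) → ∣ degree glued (a ↑ˡ n) - degree glued (m ↑ʳ w) ∣ ≡ 1
    stepwise-KG a w e with w ≟ v | to T-∧ (subst T (adj-KG a w) e)
    ... | yes refl | isPort , _ = trans (cong₂ ∣_-_∣ (degree-K a) degree-v≡3) (fit a isPort)
    ... | no w≢v   | _ , atV = ⊥-elim (subst T (dec-false (w ≟ v) w≢v) atV)

    stepwise : StepwiseIrregular glued
    stepwise x y e with block m n x | block m n y
    ... | first a  | first b   =
      trans (cong₂ ∣_-_∣ (degree-K a) (degree-K b)) (stays a b (subst T (adj-KK a b) e))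
    ... | first a  | second w  = stepwise-KG a w e
    ... | second w | first a   =
      trans (∣-∣-comm (degree glued (m ↑ʳ w)) _) (stepwise-KG a w (Adj-sym glued e))
    ... | second w | second w′ = stepwise-GG w w′ (subst T (adj-GG w w′) e)

    -- Every vertex reaches v: host vertices inside G, gadget vertices through a port.
    reaches-v : ∀ x → Star (Adj glued) x (m ↑ʳ v)
    reaches-v x with block m n x
    ... | second w = gmap (m ↑ʳ_) (λ {w} {w′} → subst T (sym (adj-GG w w′))) (conG w v)
    ... | first a with reach a
    ... | p , isPort , a⇝p =
      gmap (_↑ˡ n) (λ {b} {b′} → subst T (sym (adj-KK b b′))) a⇝p
        ◅◅ subst T (sym (adj-KG p v)) (from T-∧ (isPort , subst T (sym (dec-true (v ≟ v) refl)) tt)) ◅ ε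

    connected : Connected glued
    connected x y = reaches-v x ◅◅ reverse (Adj-sym glued) (reaches-v y)

record Gadget (m c : ℕ) : Set where
  field
    body        : Graph m
    port        : Fin m → Bool
    twoPorts    : sum (ind ∘ port) ≡ 2
    edgeSurplus : edgeCount body + 2 ≡ m + c
    stays       : StaysStepwise body port
    fit         : PortsFit body port
    reach       : ReachesPort body port

PendantVertex : ∀ {n} → Graph n → Set
PendantVertex {n} G = ∃ λ (v : Fin n) → degree G v ≡ 1

record Extends {n N} (G : Graph n) (H : Graph N) (e : ℕ) : Set where
  constructor extends
  field
    connected : Connected H
    stepwise  : StepwiseIrregular H
    edges     : edgeCount H ≡ e + edgeCount G

Extends-trans : ∀ {n N N′} {G : Graph n} {H : Graph N} {H′ : Graph N′} {e e′ e″} →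
                e′ + e ≡ e″ → Extends G H e → Extends H H′ e′ → Extends G H′ e″
Extends-trans {G = G} {e = e} {e′} total (extends _ _ edges) (extends conH′ siH′ edges′) =
  extends conH′ siH′ (trans edges′ (trans (cong (_+_ e′) edges)
                                     (trans (sym (+-assoc e′ e _)) (cong (λ x → x + edgeCount G) total))))

reorder : ∀ {N N′} (P : ∀ {N} → Graph N → Set) → N ≡ N′ → Σ (Graph N) P → Σ (Graph N′) P
reorder P refl x = x

-- The gadget vertices keep their glued degrees, so pendant vertices of the
-- gadget become pendant vertices of the result.
attach : ∀ {m c n} (g : Gadget m c) (G : Graph n) →
         Connected G → StepwiseIrregular G → PendantVertex G →
         Σ (Graph (m + n)) λ H → Extends G H (m + c) ×
           (∀ a → degree H (a ↑ˡ n) ≡ gluedDegree (Gadget.body g) (Gadget.port g) a)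
attach {m} {c} g G conG siG (v , pendant) = glued , extends connected stepwise edges , degree-K
  where
  open Gadget g
  open Gluing body port G v
  open Invariants conG siG pendant twoPorts stays fit reach
  edges : edgeCount glued ≡ (m + c) + edgeCount G
  edges = trans edgeCount-glued
    (cong (λ x → x + edgeCount G) (trans (cong (_+_ (edgeCount body)) twoPorts) edgeSurplus))

staysStepwise? : ∀ {m} (K : Graph m) port → Dec (StaysStepwise K port)
staysStepwise? K port = all? λ a → all? λ b →
  T? (adj K a b) →-dec (∣ gluedDegree K port a - gluedDegree K port b ∣ ≟ℕ 1)

portsFit? : ∀ {m} (K : Graph m) port → Dec (PortsFit K port)
portsFit? K port = all? λ a → T? (port a) →-dec (∣ gluedDegree K port a - 3 ∣ ≟ℕ 1)

listed : List (ℕ × ℕ) → ℕ → ℕ → Bool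
listed es x y = (x <ᵇ y) ∧ any (λ e → (proj₁ e ≡ᵇ x) ∧ (proj₂ e ≡ᵇ y)) es

fromEdges : ∀ m → List (ℕ × ℕ) → Graph m
fromEdges m es = record
  { adj     = λ a b → listed es (toℕ a) (toℕ b) ∨ listed es (toℕ b) (toℕ a)
  ; adj-sym = λ a b → ∨-comm (listed es (toℕ a) (toℕ b)) _
  ; irrefl  = λ a → loopless (toℕ a)
  }
  where
  loopless : ∀ x → (listed es x x ∨ listed es x x) ≡ false
  loopless x rewrite dec-false (T? (x <ᵇ x)) (λ x<x → n≮n x (<ᵇ⇒< x x x<x)) = refl

portsAt : ∀ {m} → List ℕ → Fin m → Bool
portsAt ps a = any (λ p → p ≡ᵇ toℕ a) ps

step : ∀ {m} (K : Graph m) {a c} b → Adj K a b → Star (Adj K) b c → Star (Adj K) a c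
step K b e walk = e ◅ walk

-- gadget₀: the edges 0–2 and 1–3 with ports 0 and 1.  Glued at v it hangs two
-- paths of length 2 from v; their ends are new pendant vertices.
body₀ : Graph 4
body₀ = fromEdges 4 ((0 , 2) ∷ (1 , 3) ∷ [])

ports₀ : Fin 4 → Bool
ports₀ = portsAt (0 ∷ 1 ∷ [])

reach₀ : ReachesPort body₀ ports₀
reach₀ 0F = 0F , tt , ε
reach₀ 1F = 1F , tt , ε
reach₀ 2F = 0F , tt , step body₀ 0F tt ε
reach₀ 3F = 1F , tt , step body₀ 1F tt ε

gadget₀ : Gadget 4 0
gadget₀ = record
  { body = body₀ ; port = ports₀ ; twoPorts = refl ; edgeSurplus = refl
  ; stays = toWitness {a? = staysStepwise? body₀ ports₀} tt
  ; fit   = toWitness {a? = portsFit? body₀ ports₀} tt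
  ; reach = reach₀
  }

pendant₀ : gluedDegree body₀ ports₀ 2F ≡ 1
pendant₀ = refl

-- gadget₁: the edges 0–2, 1–2, 2–3, 3–4 with ports 0 and 1.  Glued at v it
-- closes the 4-cycle v 0 2 1 and hangs the path 2 3 4.
body₁ : Graph 5
body₁ = fromEdges 5 ((0 , 2) ∷ (1 , 2) ∷ (2 , 3) ∷ (3 , 4) ∷ [])

ports₁ : Fin 5 → Bool
ports₁ = portsAt (0 ∷ 1 ∷ [])

reach₁ : ReachesPort body₁ ports₁
reach₁ 0F = 0F , tt , ε
reach₁ 1F = 1F , tt , ε
reach₁ 2F = 0F , tt , step body₁ 0F tt ε
reach₁ 3F = 0F , tt , step body₁ 2F tt (step body₁ 0F tt ε)
reach₁ 4F = 0F , tt , step body₁ 3F tt (step body₁ 2F tt (step body₁ 0F tt ε))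

gadget₁ : Gadget 5 1
gadget₁ = record
  { body = body₁ ; port = ports₁ ; twoPorts = refl ; edgeSurplus = refl
  ; stays = toWitness {a? = staysStepwise? body₁ ports₁} tt
  ; fit   = toWitness {a? = portsFit? body₁ ports₁} tt
  ; reach = reach₁
  }

-- gadget₂: the 4-cycle 0 1 4 2 with pendant edges 0–3 and 4–5, ports 3 and 5.
-- Glued at v it also closes the cycle v 3 0 1 4 5.
body₂ : Graph 6
body₂ = fromEdges 6 ((0 , 1) ∷ (0 , 2) ∷ (0 , 3) ∷ (1 , 4) ∷ (2 , 4) ∷ (4 , 5) ∷ [])

ports₂ : Fin 6 → Bool
ports₂ = portsAt (3 ∷ 5 ∷ [])

reach₂ : ReachesPort body₂ ports₂
reach₂ 0F = 3F , tt , step body₂ 3F tt ε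
reach₂ 1F = 3F , tt , step body₂ 0F tt (step body₂ 3F tt ε)
reach₂ 2F = 3F , tt , step body₂ 0F tt (step body₂ 3F tt ε)
reach₂ 3F = 3F , tt , ε
reach₂ 4F = 5F , tt , step body₂ 5F tt ε
reach₂ 5F = 5F , tt , ε

gadget₂ : Gadget 6 2
gadget₂ = record
  { body = body₂ ; port = ports₂ ; twoPorts = refl ; edgeSurplus = refl
  ; stays = toWitness {a? = staysStepwise? body₂ ports₂} tt
  ; fit   = toWitness {a? = portsFit? body₂ ports₂} tt
  ; reach = reach₂
  }

grow₀ : ∀ {n} (H : Graph n) → Connected H → StepwiseIrregular H → PendantVertex H →
        Σ (Graph (4 + n)) λ H′ → Extends H H′ 4 × PendantVertex H′
grow₀ {n} H conH siH pendH with attach gadget₀ H conH siH pendH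
... | H′ , extH′ , degreeH′ = H′ , extH′ , (2F ↑ˡ n , trans (degreeH′ 2F) pendant₀)

chain : ∀ k {n} (G : Graph n) → Connected G → StepwiseIrregular G → PendantVertex G →
        Σ (Graph (4 * k + n)) λ H → Extends G H (4 * k) × PendantVertex H
chain zero    G conG siG pendG = G , extends conG siG refl , pendG
chain (suc k) {n} G conG siG pendG with chain k G conG siG pendG
... | H , extH@(extends conH siH _) , pendH with grow₀ H conH siH pendH
... | H′ , extH′ , pendH′ =
  reorder (λ X → Extends G X (4 * suc k) × PendantVertex X) (orders k n)
          (H′ , Extends-trans (edges k) extH extH′ , pendH′)
  where
  orders : ∀ k n → 4 + (4 * k + n) ≡ 4 * suc k + n
  orders = solve-∀
  edges : ∀ k → 4 + 4 * k ≡ 4 * suc k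
  edges = solve-∀

lastGadget : ∀ i → i ≤ 2 → Gadget (4 + i) i
lastGadget 0 _ = gadget₀
lastGadget 1 _ = gadget₁
lastGadget 2 _ = gadget₂
lastGadget (suc (suc (suc _))) (s≤s (s≤s ()))

cyclomatic-growth : ∀ {n N} (G : Graph n) (H : Graph N) a i →
                    N ≡ a + n → edgeCount H ≡ (a + i) + edgeCount G →
                    cyclomatic H ≡ cyclomatic G ℤ.+ + i
cyclomatic-growth {n} G H a i refl edges = begin
  (+ edgeCount H ℤ.- + (a + n)) ℤ.+ + 1
    ≡⟨ cong (λ e → (+ e ℤ.- + (a + n)) ℤ.+ + 1) edges ⟩
  (+ ((a + i) + edgeCount G) ℤ.- + (a + n)) ℤ.+ + 1
    ≡⟨ cong₂ (λ x y → (x ℤ.- y) ℤ.+ + 1)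
             (trans (pos-+ (a + i) (edgeCount G)) (cong (λ x → x ℤ.+ + edgeCount G) (pos-+ a i)))
             (pos-+ a n) ⟩
  (((+ a ℤ.+ + i) ℤ.+ + edgeCount G) ℤ.- (+ a ℤ.+ + n)) ℤ.+ + 1
    ≡⟨ regroup (+ a) (+ i) (+ edgeCount G) (+ n) ⟩
  ((+ edgeCount G ℤ.- + n) ℤ.+ + 1) ℤ.+ + i ∎
  where
  open ≡-Reasoning
  regroup : ∀ A I E M → (((A ℤ.+ I) ℤ.+ E) ℤ.- (A ℤ.+ M)) ℤ.+ + 1 ≡ ((E ℤ.- M) ℤ.+ + 1) ℤ.+ I
  regroup = ℤ-Solver.solve-∀

mainTheorem6 : ∀ {n} (G : Graph n) → Connected G → StepwiseIrregular G →
                 (∃ λ (v : Fin n) → degree G v ≡ 1) →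
                 ∀ (k i : ℕ) → 1 ≤ k → i ≤ 2 →
                 Σ (Graph (n + 4 * k + i)) λ H →
                   Connected H × StepwiseIrregular H ×
                   cyclomatic H ≡ cyclomatic G ℤ.+ + i
mainTheorem6 G conG siG pendG zero i () _
mainTheorem6 {n} G conG siG pendG (suc k) i _ i≤2 =
  let H , extH@(extends conH siH _) , pendH = chain k G conG siG pendG
      H′ , extH′ , _                          = attach (lastGadget i i≤2) H conH siH pendH
      H″ , extends conH″ siH″ edgesH″          =
        reorder (λ X → Extends G X (a + i)) (orders n k i)
          (H′ , Extends-trans (edges k i) extH extH′)
  in H″ , conH″ , siH″ , cyclomatic-growth G H″ a i (added n k i) edgesH″
  where
  a : ℕ
  a = 4 * suc k + i
  orders : ∀ n k i → (4 + i) + (4 * k + n) ≡ n + 4 * suc k + i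
  orders = solve-∀
  edges : ∀ k i → ((4 + i) + i) + 4 * k ≡ (4 * suc k + i) + i
  edges = solve-∀
  added : ∀ n k i → n + 4 * suc k + i ≡ (4 * suc k + i) + n
  added = solve-∀
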